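{- Let $a(n)=3^n-(-1)^n$ and let $b(n)=1$ if $n=0$ and $b(n)=0$ if $n>0$. For every $n\ge0$, the number of indices $0\le i<3^n$ with $C_n(i)=1$ is $b(n)+a(n)/2$. For $1\le k\le n$, the number of indices with $C_n(i)=3^k$ is $b(n-k)+a(n-k)$; among these, the number that are strict local maxima (peaks) of $C_n$ is $b(n-k)+a(n-k)/2$, and the number that are not is $a(n-k)/2$.
   Context: The unit weight-$3$ Stern–Brocot sequences $SB_n$ ($n\ge0$): $SB_0=(\frac{0}{1},\frac{1}{1})$, and $SB_{n+1}$ is obtained from $SB_n$ by keeping all its terms in order and inserting, between each pair of consecutive terms $\frac{p}{q},\frac{r}{s}$ (in lowest terms, positive denominators), the two fractions $\frac{2p+r}{2q+s}$ and $\frac{p+2r}{q+2s}$, each reduced to lowest terms, in this order. $SB_n$ has $3^n+1$ terms, indexed from $0$. For $0\le i<3^n$, $C_n(i)=qr-ps$ where $\frac{p}{q}$ and $\frac{r}{s}$ are the $i$-th and $(i+1)$-th terms of $SB_n$ in lowest terms with positive denominators. $C_n(i)$ is a strict local maximum (a peak) if $C_n(i)>C_n(j)$ for each $j\in\{i-1,i+1\}$ with $0\le j<3^n$. -}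

module Defs where

open import Data.Nat using (ℕ; zero; suc; _+_; _*_; _∸_; _^_; _<_; _≤_; _≤?_; _<?_)
open import Data.Nat.GCD using (gcd)
import Data.Nat as ℕ
open import Data.Integer as ℤ using (ℤ; +_; -[1+_]; _-_; _/ℕ_)
import Data.Integer.Properties as ℤP
open import Data.Product using (_×_; _,_)
open import Data.List using (List; []; _∷_; length; filter; upTo)
open import Relation.Nullary using (Dec; yes; no; ¬_)
open import Relation.Nullary.Decidable using (_×-dec_; _→-dec_)
open import Relation.Binary.PropositionalEquality using (_≡_)

-- A fraction p/q is represented by the pair (p , q) of naturals
-- (all terms of SB_n lie in [0,1], so numerators are nonnegative).
Frac : Set
Frac = ℕ × ℕ

reduce : Frac → Frac
reduce (p , q) with gcd p q
... | zero  = (p , q)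
... | suc g = (p ℕ./ suc g , q ℕ./ suc g)

ins₁ : Frac → Frac → Frac
ins₁ (p , q) (r , s) = reduce (2 * p + r , 2 * q + s)

ins₂ : Frac → Frac → Frac
ins₂ (p , q) (r , s) = reduce (p + 2 * r , q + 2 * s)

step : List Frac → List Frac
step []           = []
step (x ∷ [])     = x ∷ []
step (x ∷ y ∷ xs) = x ∷ ins₁ x y ∷ ins₂ x y ∷ step (y ∷ xs)

SB : ℕ → List Frac
SB zero    = (0 , 1) ∷ (1 , 1) ∷ []
SB (suc n) = step (SB n)

dets : List Frac → List ℤ
dets []                         = []
dets (_ ∷ [])                   = []
dets ((p , q) ∷ (r , s) ∷ xs)   = ((+ (q * r)) - (+ (p * s))) ∷ dets ((r , s) ∷ xs)

nth : List ℤ → ℕ → ℤ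
nth []       _       = + 0
nth (x ∷ _)  zero    = x
nth (_ ∷ xs) (suc i) = nth xs i

-- C_n(i) for 0 ≤ i < 3^n (value + 0 outside that range, never used there)
C : ℕ → ℕ → ℤ
C n i = nth (dets (SB n)) i

Peak : ℕ → ℕ → Set
Peak n i = (1 ≤ i → C n (i ∸ 1) ℤ.< C n i) × (suc i < 3 ^ n → C n (suc i) ℤ.< C n i)

peak? : ∀ n i → Dec (Peak n i)
peak? n i = (1 ≤? i →-dec (C n (i ∸ 1) ℤ.<? C n i)) ×-dec (suc i <? 3 ^ n →-dec (C n (suc i) ℤ.<? C n i))

countVal : ℕ → ℤ → ℕ
countVal n v = length (filter (λ i → C n i ℤ.≟ v) (upTo (3 ^ n)))

countPeak : ℕ → ℤ → ℕ
countPeak n v = length (filter (λ i → (C n i ℤ.≟ v) ×-dec peak? n i) (upTo (3 ^ n)))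

countNonPeak : ℕ → ℤ → ℕ
countNonPeak n v = length (filter (λ i → (C n i ℤ.≟ v) ×-dec (Relation.Nullary.Decidable.¬? (peak? n i))) (upTo (3 ^ n)))
  where import Relation.Nullary.Decidable

a : ℕ → ℤ
a n = (+ (3 ^ n)) - (-[1+ 0 ] ℤ.^ n)

b : ℕ → ℤ
b zero    = + 1
b (suc _) = + 0

{-# OPTIONS --safe #-}
module Submission where

-- Consecutive terms of SB_n always have the form x = a e + b f, y = c e + d f for a unimodular
-- pair (e, f) and a matrix (a b; c d) of one of four shapes: the identity (type one),
-- (h+1 h; h h+1) with 1 + 2h = 3^(j+1) (type peak j), or (1 0; 1 3^(j+1)) and its mirror image
-- (3^(j+1) 1; 0 1) (type flat j).  Trisecting each shape and reducing to lowest terms gives shapes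
-- again:  one ↦ one, peak 0, one;  peak j ↦ flat j, peak (j+1), flat j;  flat 0 ↦ one, one, one;
-- flat (j+1) ↦ flat j, flat j, flat j.  So C_n lists the determinants 1 and 3^(j+1) of the n-th
-- iterate of this substitution on [one]; as outer children never exceed their middle sibling, the
-- peaks of C_n are exactly the middle children of type peak, and the numbers of each type satisfy
-- linear recurrences solved by a(m)/2 = (3^m − (−1)^m)/2.

open import Defs

module Intervals where

  open import Data.Nat using (ℕ; zero; suc; _+_; _*_; _^_; _/_; NonZero)
  open import Data.Nat.Properties
    using (+-cancelʳ-≡; +-comm; +-identityʳ; *-comm; *-identityʳ; *-assoc; *-distribˡ-+)
  open import Data.Nat.DivMod using (m*n/n≡m)
  open import Data.Nat.GCD using (gcd; c*gcd[m,n]≡gcd[cm,cn])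
  open import Data.Nat.Coprimality using (Coprime; coprime⇒gcd≡1; 1-coprimeTo; coprime-+)
  import Data.Nat.Coprimality as Coprime
  open import Data.Nat.Divisibility using (_∣_; ∣m+n∣m⇒∣n; ∣n⇒∣m*n)
  open import Data.Nat.Tactic.RingSolver using (solve-∀; solve)
  open import Data.Integer as ℤ using (ℤ; +_; _⊖_)
  import Data.Integer.Properties as ℤ
  open import Data.List using (List; []; _∷_; map)
  open import Data.Product using (_,_; proj₁; proj₂)
  open import Function using (_$_)
  open import Relation.Binary.PropositionalEquality
  open ≡-Reasoning

  record Unimodular (e f : Frac) : Set where
    constructor unimodular
    field
      cross≡ : proj₂ e * proj₁ f ≡ proj₁ e * proj₂ f + 1

  -- Opaque, so that unification can read the coefficients off linComb a b e f.
  opaque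
    linComb : ℕ → ℕ → Frac → Frac → Frac
    linComb a b (p , q) (r , s) = (a * p + b * r , a * q + b * s)

  det : Frac → Frac → ℤ
  det (p , q) (r , s) = + (q * r) ℤ.- + (p * s)

  private
    variable
      e f x y : Frac
      xs : List Frac

  -- det (linComb a b e f) (linComb c d e f) = (a d − b c) · det e f, without subtractions.
  linComb-det : ∀ {p q r s} a b c d → Unimodular (p , q) (r , s) →
    (a * q + b * s) * (c * p + d * r) + b * c ≡ (a * p + b * r) * (c * q + d * s) + a * d
  linComb-det {p} {q} {r} {s} a b c d (unimodular qr≡ps+1) = begin
    (a * q + b * s) * (c * p + d * r) + b * c
      ≡⟨ expand a b c d p q r s ⟩
    a * c * p * q + a * d * (q * r) + b * c * (p * s + 1) + b * d * r * s
      ≡⟨ cong (λ x → a * c * p * q + a * d * x + b * c * (p * s + 1) + b * d * r * s) qr≡ps+1 ⟩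
    a * c * p * q + a * d * (p * s + 1) + b * c * (p * s + 1) + b * d * r * s
      ≡⟨ cong (λ x → a * c * p * q + a * d * (p * s + 1) + b * c * x + b * d * r * s) (sym qr≡ps+1) ⟩
    a * c * p * q + a * d * (p * s + 1) + b * c * (q * r) + b * d * r * s
      ≡⟨ collect a b c d p q r s ⟩
    (a * p + b * r) * (c * q + d * s) + a * d
      ∎
    where
    expand : ∀ a b c d p q r s → (a * q + b * s) * (c * p + d * r) + b * c
      ≡ a * c * p * q + a * d * (q * r) + b * c * (p * s + 1) + b * d * r * s
    expand = solve-∀
    collect : ∀ a b c d p q r s → a * c * p * q + a * d * (p * s + 1) + b * c * (q * r) + b * d * r * s
      ≡ (a * p + b * r) * (c * q + d * s) + a * d
    collect = solve-∀

  m+n′≡m′+n⇒m⊖n≡m′⊖n′ : ∀ m n m′ n′ → m + n′ ≡ m′ + n → m ⊖ n ≡ m′ ⊖ n′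
  m+n′≡m′+n⇒m⊖n≡m′⊖n′ m n m′ n′ eq = begin
    m ⊖ n                ≡⟨ ℤ.+-cancelˡ-⊖ n′ m n ⟨
    (n′ + m) ⊖ (n′ + n)  ≡⟨ cong₂ _⊖_ (trans (+-comm n′ m) (trans eq (+-comm m′ n))) (+-comm n′ n) ⟩
    (n + m′) ⊖ (n + n′)  ≡⟨ ℤ.+-cancelˡ-⊖ n m′ n′ ⟩
    m′ ⊖ n′              ∎

  reduce-gcd : ∀ {P Q} g → gcd P Q ≡ suc g → reduce (P , Q) ≡ (P / suc g , Q / suc g)
  reduce-gcd {P} {Q} g gcd≡ with gcd P Q
  reduce-gcd g refl | .(suc g) = refl

  opaque
    unfolding linComb

    linComb-1-0 : ∀ e f → linComb 1 0 e f ≡ e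
    linComb-1-0 (p , q) (r , s) = cong₂ _,_ (solve (p ∷ r ∷ [])) (solve (q ∷ s ∷ []))

    linComb-0-1 : ∀ e f → linComb 0 1 e f ≡ f
    linComb-0-1 (p , q) (r , s) = cong₂ _,_ (solve (p ∷ r ∷ [])) (solve (q ∷ s ∷ []))

    linComb-linComb : ∀ a b a′ b′ c′ d′ e f →
      linComb (a * a′ + b * c′) (a * b′ + b * d′) e f ≡ linComb a b (linComb a′ b′ e f) (linComb c′ d′ e f)
    linComb-linComb a b a′ b′ c′ d′ (p , q) (r , s) = cong₂ _,_ (assoc p r) (assoc q s)
      where
      assoc : ∀ p r →
        (a * a′ + b * c′) * p + (a * b′ + b * d′) * r ≡ a * (a′ * p + b′ * r) + b * (c′ * p + d′ * r)
      assoc p r = solve (a ∷ b ∷ a′ ∷ b′ ∷ c′ ∷ d′ ∷ p ∷ r ∷ [])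

    unimodular-linComb : ∀ {a b c d} → Unimodular e f → a * d ≡ b * c + 1 →
      Unimodular (linComb a b e f) (linComb c d e f)
    unimodular-linComb {p , q} {r , s} {a} {b} {c} {d} u ad≡bc+1 = unimodular $
      +-cancelʳ-≡ (b * c) _ _ (begin
        Q * R + b * c        ≡⟨ linComb-det a b c d u ⟩
        P * S + a * d        ≡⟨ cong (λ x → P * S + x) ad≡bc+1 ⟩
        P * S + (b * c + 1)  ≡⟨ shuffle (P * S) (b * c) ⟩
        P * S + 1 + b * c    ∎)
      where
      P Q R S : ℕ
      P = a * p + b * r
      Q = a * q + b * s
      R = c * p + d * r
      S = c * q + d * s
      shuffle : ∀ x y → x + (y + 1) ≡ x + 1 + y
      shuffle = solve-∀

    det-linComb : ∀ a b c d → Unimodular e f → det (linComb a b e f) (linComb c d e f) ≡ a * d ⊖ b * c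
    det-linComb {p , q} {r , s} a b c d u = begin
      + X ℤ.- + Y
        ≡⟨ ℤ.[+m]-[+n]≡m⊖n X Y ⟩
      X ⊖ Y
        ≡⟨ m+n′≡m′+n⇒m⊖n≡m′⊖n′ X Y (a * d) (b * c) (trans (linComb-det a b c d u) (+-comm Y (a * d))) ⟩
      a * d ⊖ b * c ∎
      where
      X Y : ℕ
      X = (a * q + b * s) * (c * p + d * r)
      Y = (a * p + b * r) * (c * q + d * s)

    ins₁-linComb : ∀ a b c d e f → ins₁ (linComb a b e f) (linComb c d e f) ≡ reduce (linComb (2 * a + c) (2 * b + d) e f)
    ins₁-linComb a b c d (p , q) (r , s) = cong reduce (cong₂ _,_ (regroup p r) (regroup q s))
      where
      regroup : ∀ p r → 2 * (a * p + b * r) + (c * p + d * r) ≡ (2 * a + c) * p + (2 * b + d) * r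
      regroup p r = solve (a ∷ b ∷ c ∷ d ∷ p ∷ r ∷ [])

    ins₂-linComb : ∀ a b c d e f → ins₂ (linComb a b e f) (linComb c d e f) ≡ reduce (linComb (a + 2 * c) (b + 2 * d) e f)
    ins₂-linComb a b c d (p , q) (r , s) = cong reduce (cong₂ _,_ (regroup p r) (regroup q s))
      where
      regroup : ∀ p r → (a * p + b * r) + 2 * (c * p + d * r) ≡ (a + 2 * c) * p + (b + 2 * d) * r
      regroup p r = solve (a ∷ b ∷ c ∷ d ∷ p ∷ r ∷ [])

    coprime-linComb : ∀ {A B} → Unimodular e f → Coprime A B → let (X , Y) = linComb A B e f in Coprime X Y
    coprime-linComb {p , q} {r , s} {A} {B} (unimodular qr≡ps+1) coprime {d} (d∣X , d∣Y) = coprime (d∣A , d∣B)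
      where
      rY≡sX+A : r * (A * q + B * s) ≡ s * (A * p + B * r) + A
      rY≡sX+A = begin
        r * (A * q + B * s)          ≡⟨ solve (A ∷ B ∷ q ∷ r ∷ s ∷ []) ⟩
        A * (q * r) + B * r * s      ≡⟨ cong (λ x → A * x + B * r * s) qr≡ps+1 ⟩
        A * (p * s + 1) + B * r * s  ≡⟨ solve (A ∷ B ∷ p ∷ r ∷ s ∷ []) ⟩
        s * (A * p + B * r) + A      ∎
      qX≡pY+B : q * (A * p + B * r) ≡ p * (A * q + B * s) + B
      qX≡pY+B = begin
        q * (A * p + B * r)          ≡⟨ solve (A ∷ B ∷ p ∷ q ∷ r ∷ []) ⟩
        A * p * q + B * (q * r)      ≡⟨ cong (λ x → A * p * q + B * x) qr≡ps+1 ⟩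
        A * p * q + B * (p * s + 1)  ≡⟨ solve (A ∷ B ∷ p ∷ q ∷ s ∷ []) ⟩
        p * (A * q + B * s) + B      ∎
      d∣A : d ∣ A
      d∣A = ∣m+n∣m⇒∣n (subst (d ∣_) rY≡sX+A (∣n⇒∣m*n r d∣Y)) (∣n⇒∣m*n s d∣X)
      d∣B : d ∣ B
      d∣B = ∣m+n∣m⇒∣n (subst (d ∣_) qX≡pY+B (∣n⇒∣m*n q d∣X)) (∣n⇒∣m*n p d∣Y)

    reduce-linComb : ∀ m {A B} .{{_ : NonZero m}} → Unimodular e f → Coprime A B →
      reduce (linComb (m * A) (m * B) e f) ≡ linComb A B e f
    reduce-linComb {p , q} {r , s} m@(suc k) {A} {B} u coprime = begin
      reduce (m * A * p + m * B * r , m * A * q + m * B * s)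
        ≡⟨ cong reduce (cong₂ _,_ (factor p r) (factor q s)) ⟩
      reduce (m * X , m * Y)
        ≡⟨ reduce-gcd k gcd≡m ⟩
      (m * X / m , m * Y / m)
        ≡⟨ cong₂ _,_ (cancel X) (cancel Y) ⟩
      (X , Y) ∎
      where
      X Y : ℕ
      X = A * p + B * r
      Y = A * q + B * s
      factor : ∀ p r → m * A * p + m * B * r ≡ m * (A * p + B * r)
      factor p r = trans (cong₂ _+_ (*-assoc m A p) (*-assoc m B r)) (sym (*-distribˡ-+ m (A * p) (B * r)))
      gcd≡m : gcd (m * X) (m * Y) ≡ m
      gcd≡m = begin
        gcd (m * X) (m * Y)  ≡⟨ c*gcd[m,n]≡gcd[cm,cn] m X Y ⟨
        m * gcd X Y          ≡⟨ cong (m *_) (coprime⇒gcd≡1 (coprime-linComb u coprime)) ⟩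
        m * 1                ≡⟨ *-identityʳ m ⟩
        m                    ∎
      cancel : ∀ x → m * x / m ≡ x
      cancel x = trans (cong (_/ m) (*-comm m x)) (m*n/n≡m x m)

  ins₁-linComb-reduced : ∀ {a b c d} m {A B} .{{_ : NonZero m}} → Unimodular e f → Coprime A B →
    2 * a + c ≡ m * A → 2 * b + d ≡ m * B → ins₁ (linComb a b e f) (linComb c d e f) ≡ linComb A B e f
  ins₁-linComb-reduced {e} {f} {a} {b} {c} {d} m {A} {B} u coprime A≡ B≡ = begin
    ins₁ (linComb a b e f) (linComb c d e f)      ≡⟨ ins₁-linComb a b c d e f ⟩
    reduce (linComb (2 * a + c) (2 * b + d) e f)  ≡⟨ cong₂ (λ A B → reduce (linComb A B e f)) A≡ B≡ ⟩
    reduce (linComb (m * A) (m * B) e f)          ≡⟨ reduce-linComb m u coprime ⟩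
    linComb A B e f                               ∎

  ins₂-linComb-reduced : ∀ {a b c d} m {A B} .{{_ : NonZero m}} → Unimodular e f → Coprime A B →
    a + 2 * c ≡ m * A → b + 2 * d ≡ m * B → ins₂ (linComb a b e f) (linComb c d e f) ≡ linComb A B e f
  ins₂-linComb-reduced {e} {f} {a} {b} {c} {d} m {A} {B} u coprime A≡ B≡ = begin
    ins₂ (linComb a b e f) (linComb c d e f)      ≡⟨ ins₂-linComb a b c d e f ⟩
    reduce (linComb (a + 2 * c) (b + 2 * d) e f)  ≡⟨ cong₂ (λ A B → reduce (linComb A B e f)) A≡ B≡ ⟩
    reduce (linComb (m * A) (m * B) e f)          ≡⟨ reduce-linComb m u coprime ⟩
    linComb A B e f                               ∎

  coprime-suc : ∀ n → Coprime (suc n) n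
  coprime-suc n = subst (λ m → Coprime m n) (+-comm n 1) (coprime-+ (1-coprimeTo n))

  data Tag : Set where
    one  : Tag
    peak : ℕ → Tag
    flat : ℕ → Tag

  outer middle : Tag → Tag
  outer one             = one
  outer (peak j)        = flat j
  outer (flat zero)     = one
  outer (flat (suc j))  = flat j
  middle one            = peak 0
  middle (peak j)       = peak (suc j)
  middle (flat zero)    = one
  middle (flat (suc j)) = flat j

  private
    variable
      t : Tag
      ts : List Tag
      j : ℕ

  data Shape : Tag → ℕ → ℕ → ℕ → ℕ → Set where
    one   : Shape one 1 0 0 1
    peak  : ∀ {h} → 1 + 2 * h ≡ 3 ^ suc j → Shape (peak j) (suc h) h h (suc h)
    flatˡ : ∀ {w} → w ≡ 3 ^ suc j → Shape (flat j) 1 0 1 w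
    flatʳ : ∀ {w} → w ≡ 3 ^ suc j → Shape (flat j) w 1 0 1

  data Interval (t : Tag) (x y : Frac) : Set where
    interval : ∀ {a b c d e f} → Shape t a b c d → Unimodular e f →
               x ≡ linComb a b e f → y ≡ linComb c d e f → Interval t x y

  record Refined (t : Tag) (x y : Frac) : Set where
    constructor ⟨_,_,_⟩
    field
      first  : Interval (outer t) x (ins₁ x y)
      second : Interval (middle t) (ins₁ x y) (ins₂ x y)
      third  : Interval (outer t) (ins₂ x y) y

  -- rebase s a′ b′ c′ d′ places the shape s on the basis (a′ e + b′ f, c′ e + d′ f); the remaining
  -- arguments check that this basis is unimodular and identify the endpoints' coefficients.
  rebase : ∀ {a b c d A B C D} → Shape t a b c d → ∀ a′ b′ c′ d′ →
    Unimodular e f → a′ * d′ ≡ b′ * c′ + 1 →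
    a * a′ + b * c′ ≡ A → a * b′ + b * d′ ≡ B → c * a′ + d * c′ ≡ C → c * b′ + d * d′ ≡ D →
    Interval t (linComb A B e f) (linComb C D e f)
  rebase {e = e} {f = f} {a = a} {b} {c} {d} shape a′ b′ c′ d′ u det≡1 refl refl refl refl =
    interval shape (unimodular-linComb {a = a′} {b′} {c′} {d′} u det≡1)
      (linComb-linComb a b a′ b′ c′ d′ e f) (linComb-linComb c d a′ b′ c′ d′ e f)

  -- Unreduced, the inserted points are m (A₁, B₁) · (e, f) and m (A₂, B₂) · (e, f) with coprime
  -- rows, so reducing them divides by m.  The shape argument only pins down a, b, c, d.
  refined : ∀ {a b c d} → Shape t a b c d → Unimodular e f →
    ∀ m A₁ B₁ A₂ B₂ .{{_ : NonZero m}} → Coprime A₁ B₁ → Coprime A₂ B₂ →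
    2 * a + c ≡ m * A₁ → 2 * b + d ≡ m * B₁ → a + 2 * c ≡ m * A₂ → b + 2 * d ≡ m * B₂ →
    Interval (outer t) (linComb a b e f) (linComb A₁ B₁ e f) →
    Interval (middle t) (linComb A₁ B₁ e f) (linComb A₂ B₂ e f) →
    Interval (outer t) (linComb A₂ B₂ e f) (linComb c d e f) →
    Refined t (linComb a b e f) (linComb c d e f)
  refined {a = a} {b} {c} {d} _ u m A₁ B₁ A₂ B₂ coprime₁ coprime₂ A₁≡ B₁≡ A₂≡ B₂≡ =
    through (ins₁-linComb-reduced {a = a} {b} {c} {d} m u coprime₁ A₁≡ B₁≡)
            (ins₂-linComb-reduced {a = a} {b} {c} {d} m u coprime₂ A₂≡ B₂≡)
    where
    through : ∀ {x y z w} → ins₁ x y ≡ z → ins₂ x y ≡ w → Interval (outer t) x z →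
      Interval (middle t) z w → Interval (outer t) w y → Refined t x y
    through refl refl left mid right = ⟨ left , mid , right ⟩

  refine-flatˡ-3* : ∀ w → w ≡ 3 ^ suc j → Unimodular e f →
    Refined (flat (suc j)) (linComb 1 0 e f) (linComb 1 (3 * w) e f)
  refine-flatˡ-3* w w≡ u =
    refined (flatˡ (cong (3 *_) w≡)) u 3 1 w 1 (2 * w) (1-coprimeTo w) (1-coprimeTo (2 * w))
      refl refl refl (solve (w ∷ []))
      (interval (flatˡ w≡) u refl refl)
      (rebase (flatˡ w≡) 1 w 0 1 u (solve (w ∷ []))
        refl (solve (w ∷ [])) (solve (w ∷ [])) (solve (w ∷ [])))
      (rebase (flatˡ w≡) 1 (2 * w) 0 1 u (solve (w ∷ []))
        refl (solve (w ∷ [])) (solve (w ∷ [])) (solve (w ∷ [])))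

  refine-flatʳ-3* : ∀ w → w ≡ 3 ^ suc j → Unimodular e f →
    Refined (flat (suc j)) (linComb (3 * w) 1 e f) (linComb 0 1 e f)
  refine-flatʳ-3* w w≡ u =
    refined (flatʳ (cong (3 *_) w≡)) u 3 (2 * w) 1 w 1
      (Coprime.sym (1-coprimeTo (2 * w))) (Coprime.sym (1-coprimeTo w))
      (solve (w ∷ [])) refl (solve (w ∷ [])) refl
      (rebase (flatʳ w≡) 1 0 (2 * w) 1 u (solve (w ∷ []))
        (solve (w ∷ [])) (solve (w ∷ [])) (solve (w ∷ [])) (solve (w ∷ [])))
      (rebase (flatʳ w≡) 1 0 w 1 u (solve (w ∷ []))
        (solve (w ∷ [])) (solve (w ∷ [])) (solve (w ∷ [])) (solve (w ∷ [])))
      (interval (flatʳ w≡) u refl refl)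

  refine-shape : ∀ {a b c d} → Shape t a b c d → Unimodular e f → Refined t (linComb a b e f) (linComb c d e f)
  refine-shape one u =
    refined one u 1 2 1 1 2 (Coprime.sym (1-coprimeTo 2)) (1-coprimeTo 2) refl refl refl refl
      (rebase one 1 0 2 1 u refl refl refl refl refl)
      (rebase (peak {h = 1} refl) 1 0 0 1 u refl refl refl refl refl)
      (rebase one 1 2 0 1 u refl refl refl refl refl)
  refine-shape (peak {j} {h} 1+2h≡) u =
    refined (peak 1+2h≡) u 1 (2 + 3 * h) (1 + 3 * h) (1 + 3 * h) (2 + 3 * h)
      (coprime-suc (suc (3 * h))) (Coprime.sym (coprime-suc (suc (3 * h))))
      (solve (h ∷ [])) (solve (h ∷ [])) (solve (h ∷ [])) (solve (h ∷ []))
      (rebase (flatˡ 1+2h≡) (suc h) h 1 1 u (solve (h ∷ []))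
        (solve (h ∷ [])) (solve (h ∷ [])) (solve (h ∷ [])) (solve (h ∷ [])))
      (interval (peak 1+2h′≡) u refl refl)
      (rebase (flatʳ 1+2h≡) 1 1 h (suc h) u (solve (h ∷ []))
        (solve (h ∷ [])) (solve (h ∷ [])) (solve (h ∷ [])) (solve (h ∷ [])))
    where
    1+2h′≡ : 1 + 2 * suc (3 * h) ≡ 3 ^ suc (suc j)
    1+2h′≡ = begin
      1 + 2 * suc (3 * h)  ≡⟨ solve (h ∷ []) ⟩
      3 * (1 + 2 * h)      ≡⟨ cong (3 *_) 1+2h≡ ⟩
      3 ^ suc (suc j)      ∎
  refine-shape (flatˡ {zero} refl) u =
    refined (flatˡ refl) u 3 1 1 1 2 (1-coprimeTo 1) (1-coprimeTo 2) refl refl refl refl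
      (rebase one 1 0 1 1 u refl refl refl refl refl)
      (rebase one 1 1 1 2 u refl refl refl refl refl)
      (rebase one 1 2 1 3 u refl refl refl refl refl)
  refine-shape (flatˡ {suc j} refl) u = refine-flatˡ-3* (3 ^ suc j) refl u
  refine-shape (flatʳ {zero} refl) u =
    refined (flatʳ refl) u 3 2 1 1 1 (Coprime.sym (1-coprimeTo 2)) (1-coprimeTo 1) refl refl refl refl
      (rebase one 3 1 2 1 u refl refl refl refl refl)
      (rebase one 2 1 1 1 u refl refl refl refl refl)
      (rebase one 1 1 0 1 u refl refl refl refl refl)
  refine-shape (flatʳ {suc j} refl) u = refine-flatʳ-3* (3 ^ suc j) refl u

  refine : Interval t x y → Refined t x y
  refine (interval shape u refl refl) = refine-shape shape u

  value : Tag → ℤ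
  value one      = + 1
  value (peak j) = + 3 ^ suc j
  value (flat j) = + 3 ^ suc j

  det-shape : ∀ {a b c d} → Shape t a b c d → a * d ⊖ b * c ≡ value t
  det-shape one = refl
  det-shape (peak {j} {h} 1+2h≡) = begin
    suc h * suc h ⊖ h * h  ≡⟨ m+n′≡m′+n⇒m⊖n≡m′⊖n′ (suc h * suc h) (h * h) (1 + 2 * h) 0 (solve (h ∷ [])) ⟩
    + (1 + 2 * h)          ≡⟨ cong +_ 1+2h≡ ⟩
    + 3 ^ suc j            ∎
  det-shape (flatˡ w≡) = cong +_ (trans (+-identityʳ _) w≡)
  det-shape (flatʳ w≡) = cong +_ (trans (*-identityʳ _) w≡)

  det-interval : Interval t x y → det x y ≡ value t
  det-interval (interval shape u refl refl) = trans (det-linComb _ _ _ _ u) (det-shape shape)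

  expand : List Tag → List Tag
  expand []       = []
  expand (t ∷ ts) = outer t ∷ middle t ∷ outer t ∷ expand ts

  data Chain : List Frac → List Tag → Set where
    [_] : ∀ x → Chain (x ∷ []) []
    _∷_ : Interval t x y → Chain (y ∷ xs) ts → Chain (x ∷ y ∷ xs) (t ∷ ts)

  dets-chain : Chain xs ts → dets xs ≡ map value ts
  dets-chain [ x ]          = refl
  dets-chain (iv ∷ chain) = cong₂ _∷_ (det-interval iv) (dets-chain chain)

  step-chain : Chain xs ts → Chain (step xs) (expand ts)
  step-chain [ x ]        = [ x ]
  step-chain (iv ∷ chain) with refine iv
  ... | ⟨ first , second , third ⟩ = first ∷ second ∷ prepend third (step-chain chain)
    where
    prepend : Interval t x y → Chain (step (y ∷ xs)) ts → Chain (x ∷ step (y ∷ xs)) (t ∷ ts)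
    prepend {xs = []}    iv′ chain′ = iv′ ∷ chain′
    prepend {xs = _ ∷ _} iv′ chain′ = iv′ ∷ chain′

  tags : ℕ → List Tag
  tags zero    = one ∷ []
  tags (suc n) = expand (tags n)

  chain-SB : ∀ n → Chain (SB n) (tags n)
  chain-SB zero    = interval one (unimodular refl) (sym (linComb-1-0 _ _)) (sym (linComb-0-1 _ _)) ∷ [ _ ]
  chain-SB (suc n) = step-chain (chain-SB n)

  dets-SB : ∀ n → dets (SB n) ≡ map value (tags n)
  dets-SB n = dets-chain (chain-SB n)

module Counting where

  open Intervals using (Tag; one; peak; flat; outer; middle; value; expand; tags; dets-SB)
  open import Data.Nat as ℕ using (ℕ; zero; suc; _+_; _*_; _^_; _∸_; _<_; _≤_; z≤n; s≤s)
  import Data.Nat.Properties as ℕ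
  open import Data.Nat.Divisibility using (_∣_; ∣1⇒≡1; m∣m*n)
  open import Data.Nat.Tactic.RingSolver using (solve-∀; solve)
  open import Data.Integer as ℤ using (ℤ; +_; +<+; +≤+)
  import Data.Integer.Properties as ℤ
  open import Data.List using (List; []; _∷_; map; length; filter; applyUpTo; upTo; head)
  open import Data.List.Properties using (filter-accept; filter-reject; length-map)
  open import Data.Maybe using (Maybe; just; nothing)
  open import Data.Maybe.Relation.Unary.All as Maybe using (just; nothing)
  open import Data.Product using (_×_; _,_)
  open import Data.Bool using (true; false)
  open import Function using (_⇔_; mk⇔; Equivalence; _∘_)
  open import Relation.Nullary using (¬_; Dec; yes; no; does; contradiction)
  open import Relation.Nullary.Decidable using (_×-dec_; ¬?)
  open import Relation.Unary using (Pred; Decidable)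
  open import Relation.Binary using (tri<; tri≈; tri>)
  open import Relation.Binary.PropositionalEquality
  open ≡-Reasoning

  private
    variable
      j : ℕ
      s t : Tag
      ts : List Tag

  total : (Tag → ℕ) → List Tag → ℕ
  total w []       = 0
  total w (t ∷ ts) = w t + total w ts

  total-cong : ∀ {w w′} → (∀ t → w t ≡ w′ t) → ∀ ts → total w ts ≡ total w′ ts
  total-cong w≗w′ []       = refl
  total-cong w≗w′ (t ∷ ts) = cong₂ _+_ (w≗w′ t) (total-cong w≗w′ ts)

  total-linear : ∀ a b u v ts → total (λ t → a * u t + b * v t) ts ≡ a * total u ts + b * total v ts
  total-linear a b u v []       = solve (a ∷ b ∷ [])
  total-linear a b u v (t ∷ ts) = begin
    a * u t + b * v t + total (λ t → a * u t + b * v t) ts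
      ≡⟨ cong (λ n → a * u t + b * v t + n) (total-linear a b u v ts) ⟩
    a * u t + b * v t + (a * total u ts + b * total v ts)
      ≡⟨ interchange a b (u t) (v t) (total u ts) (total v ts) ⟩
    a * (u t + total u ts) + b * (v t + total v ts) ∎
    where
    interchange : ∀ a b x y X Y → a * x + b * y + (a * X + b * Y) ≡ a * (x + X) + b * (y + Y)
    interchange = solve-∀

  total-expand : ∀ w ts → total w (expand ts) ≡ total (λ t → 2 * w (outer t) + w (middle t)) ts
  total-expand w []       = refl
  total-expand w (t ∷ ts) = begin
    w (outer t) + (w (middle t) + (w (outer t) + total w (expand ts)))
      ≡⟨ regroup (w (outer t)) (w (middle t)) (total w (expand ts)) ⟩
    2 * w (outer t) + w (middle t) + total w (expand ts)
      ≡⟨ cong (λ n → 2 * w (outer t) + w (middle t) + n) (total-expand w ts) ⟩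
    2 * w (outer t) + w (middle t) + total (λ t → 2 * w (outer t) + w (middle t)) ts ∎
    where
    regroup : ∀ o c r → o + (c + (o + r)) ≡ 2 * o + c + r
    regroup = solve-∀

  δ : ℕ → ℕ → ℕ
  δ zero    zero    = 1
  δ zero    (suc _) = 0
  δ (suc _) zero    = 0
  δ (suc i) (suc j) = δ i j

  δᵗ : Tag → Tag → ℕ
  δᵗ one      one      = 1
  δᵗ (peak i) (peak j) = δ i j
  δᵗ (flat i) (flat j) = δ i j
  δᵗ _        _        = 0

  count : Tag → List Tag → ℕ
  count t = total (δᵗ t)

  count-expand : ∀ t w → (∀ s → 2 * δᵗ t (outer s) + δᵗ t (middle s) ≡ w s) →
    ∀ ts → count t (expand ts) ≡ total w ts
  count-expand t w pointwise ts = trans (total-expand (δᵗ t) ts) (total-cong pointwise ts)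

  count-one-expand : ∀ ts → count one (expand ts) ≡ 2 * count one ts + 3 * count (flat 0) ts
  count-one-expand ts = trans (count-expand one _ pointwise ts) (total-linear 2 3 (δᵗ one) (δᵗ (flat 0)) ts)
    where
    pointwise : ∀ s → 2 * δᵗ one (outer s) + δᵗ one (middle s) ≡ 2 * δᵗ one s + 3 * δᵗ (flat 0) s
    pointwise one            = refl
    pointwise (peak _)       = refl
    pointwise (flat zero)    = refl
    pointwise (flat (suc _)) = refl

  count-peak-zero-expand : ∀ ts → count (peak 0) (expand ts) ≡ count one ts
  count-peak-zero-expand = count-expand (peak 0) (δᵗ one) λ where
    one            → refl
    (peak _)       → refl
    (flat zero)    → refl
    (flat (suc _)) → refl

  count-peak-suc-expand : ∀ j ts → count (peak (suc j)) (expand ts) ≡ count (peak j) ts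
  count-peak-suc-expand j = count-expand (peak (suc j)) (δᵗ (peak j)) λ where
    one            → refl
    (peak _)       → refl
    (flat zero)    → refl
    (flat (suc _)) → refl

  count-flat-expand : ∀ j ts → count (flat j) (expand ts) ≡ 2 * count (peak j) ts + 3 * count (flat (suc j)) ts
  count-flat-expand j ts =
    trans (count-expand (flat j) _ pointwise ts) (total-linear 2 3 (δᵗ (peak j)) (δᵗ (flat (suc j))) ts)
    where
    pointwise : ∀ s →
      2 * δᵗ (flat j) (outer s) + δᵗ (flat j) (middle s) ≡ 2 * δᵗ (peak j) s + 3 * δᵗ (flat (suc j)) s
    pointwise one            = refl
    pointwise (peak _)       = refl
    pointwise (flat zero)    = refl
    pointwise (flat (suc i)) = triple (δ j i)
      where
      triple : ∀ x → 2 * x + x ≡ 3 * x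
      triple = solve-∀

  tagCount : Tag → ℕ → ℕ
  tagCount t n = count t (tags n)

  tagCount-peak-suc : ∀ j n → tagCount (peak (suc j)) (suc n) ≡ tagCount (peak j) n
  tagCount-peak-suc j n = count-peak-suc-expand j (tags n)

  tagCount-flat-suc : ∀ j n → tagCount (flat (suc j)) (suc n) ≡ tagCount (flat j) n
  tagCount-flat-suc j zero    = refl
  tagCount-flat-suc j (suc n) = begin
    tagCount (flat (suc j)) (suc (suc n))
      ≡⟨ count-flat-expand (suc j) (tags (suc n)) ⟩
    2 * tagCount (peak (suc j)) (suc n) + 3 * tagCount (flat (suc (suc j))) (suc n)
      ≡⟨ cong₂ (λ p q → 2 * p + 3 * q) (tagCount-peak-suc j n) (tagCount-flat-suc (suc j) n) ⟩
    2 * tagCount (peak j) n + 3 * tagCount (flat (suc j)) n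
      ≡⟨ count-flat-expand j (tags n) ⟨
    tagCount (flat j) (suc n) ∎

  tagCount-peak : ∀ j m → tagCount (peak j) (suc j + m) ≡ tagCount one m
  tagCount-peak zero    m = count-peak-zero-expand (tags m)
  tagCount-peak (suc j) m = trans (tagCount-peak-suc j (suc j + m)) (tagCount-peak j m)

  -- a(m)/2, through the recurrence x(m+2) = 2 x(m+1) + 3 x(m) satisfied by 3^m and (−1)^m.
  half-a : ℕ → ℕ
  half-a zero          = 0
  half-a (suc zero)    = 2
  half-a (suc (suc m)) = 2 * half-a (suc m) + 3 * half-a m

  tagCount-one-suc≡tagCount-flat₀ : ∀ m → tagCount one (suc m) ≡ tagCount (flat 0) (suc (suc m))
  tagCount-one-suc≡tagCount-flat₀ m = begin
    tagCount one (suc m)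
      ≡⟨ count-one-expand (tags m) ⟩
    2 * tagCount one m + 3 * tagCount (flat 0) m
      ≡⟨ cong₂ (λ p q → 2 * p + 3 * q) (tagCount-peak 0 m) (tagCount-flat-suc 0 m) ⟨
    2 * tagCount (peak 0) (suc m) + 3 * tagCount (flat 1) (suc m)
      ≡⟨ count-flat-expand 0 (tags (suc m)) ⟨
    tagCount (flat 0) (suc (suc m)) ∎

  tagCount-flat₀ : ∀ m → tagCount (flat 0) (suc m) ≡ half-a m
  tagCount-flat₀ zero          = refl
  tagCount-flat₀ (suc zero)    = refl
  tagCount-flat₀ (suc (suc m)) = begin
    tagCount (flat 0) (3 + m)
      ≡⟨ count-flat-expand 0 (tags (2 + m)) ⟩
    2 * tagCount (peak 0) (2 + m) + 3 * tagCount (flat 1) (2 + m)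
      ≡⟨ cong₂ (λ p q → 2 * p + 3 * q) (tagCount-peak 0 (suc m)) (tagCount-flat-suc 0 (suc m)) ⟩
    2 * tagCount one (1 + m) + 3 * tagCount (flat 0) (1 + m)
      ≡⟨ cong₂ (λ p q → 2 * p + 3 * q)
               (trans (tagCount-one-suc≡tagCount-flat₀ m) (tagCount-flat₀ (suc m))) (tagCount-flat₀ m) ⟩
    2 * half-a (suc m) + 3 * half-a m ∎

  tagCount-one-suc : ∀ m → tagCount one (suc m) ≡ half-a (suc m)
  tagCount-one-suc m = trans (tagCount-one-suc≡tagCount-flat₀ m) (tagCount-flat₀ (suc m))

  tagCount-flat : ∀ j m → tagCount (flat j) (suc j + m) ≡ half-a m
  tagCount-flat zero    m = tagCount-flat₀ m
  tagCount-flat (suc j) m = trans (tagCount-flat-suc j (suc j + m)) (tagCount-flat j m)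

  δ-refl : ∀ i → δ i i ≡ 1
  δ-refl zero    = refl
  δ-refl (suc i) = δ-refl i

  δ-≢ : ∀ {i j} → i ≢ j → δ i j ≡ 0
  δ-≢ {zero}  {zero}  i≢j = contradiction refl i≢j
  δ-≢ {zero}  {suc j} _   = refl
  δ-≢ {suc i} {zero}  _   = refl
  δ-≢ {suc i} {suc j} i≢j = δ-≢ (i≢j ∘ cong suc)

  3^-injective : ∀ {i j} → 3 ^ i ≡ 3 ^ j → i ≡ j
  3^-injective {i} {j} 3^i≡3^j with ℕ.<-cmp i j
  ... | tri< i<j _ _ = contradiction 3^i≡3^j (ℕ.<⇒≢ (ℕ.^-monoʳ-< 3 (s≤s (s≤s z≤n)) i<j))
  ... | tri≈ _ i≡j _ = i≡j
  ... | tri> _ _ i>j = contradiction (sym 3^i≡3^j) (ℕ.<⇒≢ (ℕ.^-monoʳ-< 3 (s≤s (s≤s z≤n)) i>j))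

  3^suc≢1 : ∀ i → 3 ^ suc i ≢ 1
  3^suc≢1 i 3^suc≡1 = contradiction (∣1⇒≡1 (subst (3 ∣_) 3^suc≡1 (m∣m*n (3 ^ i)))) λ ()

  total-+ : ∀ u v ts → total (λ t → u t + v t) ts ≡ total u ts + total v ts
  total-+ u v []       = refl
  total-+ u v (t ∷ ts) =
    trans (cong (λ x → u t + v t + x) (total-+ u v ts)) (interchange (u t) (v t) (total u ts) (total v ts))
    where
    interchange : ∀ a b A B → a + b + (A + B) ≡ a + A + (b + B)
    interchange = solve-∀

  length-filter-map-value : ∀ {p} {P : Pred ℤ p} (P? : Decidable P) (w : Tag → ℕ) →
    (∀ t → P (value t) → w t ≡ 1) → (∀ t → ¬ P (value t) → w t ≡ 0) →
    ∀ ts → length (filter P? (map value ts)) ≡ total w ts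
  length-filter-map-value P? w accept reject [] = refl
  length-filter-map-value P? w accept reject (t ∷ ts) with P? (value t)
  ... | yes p = cong₂ _+_ (sym (accept t p)) (length-filter-map-value P? w accept reject ts)
  ... | no ¬p = cong₂ _+_ (sym (reject t ¬p)) (length-filter-map-value P? w accept reject ts)

  count-value-one : ∀ ts → length (filter (ℤ._≟ + 1) (map value ts)) ≡ count one ts
  count-value-one = length-filter-map-value (ℤ._≟ + 1) (δᵗ one) accept reject
    where
    accept : ∀ t → value t ≡ + 1 → δᵗ one t ≡ 1
    accept one      _    = refl
    accept (peak i) 3^≡1 = contradiction (ℤ.+-injective 3^≡1) (3^suc≢1 i)
    accept (flat i) 3^≡1 = contradiction (ℤ.+-injective 3^≡1) (3^suc≢1 i)
    reject : ∀ t → value t ≢ + 1 → δᵗ one t ≡ 0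
    reject one      ≢1 = contradiction refl ≢1
    reject (peak _) _  = refl
    reject (flat _) _  = refl

  count-value-3^ : ∀ j ts → length (filter (ℤ._≟ + 3 ^ suc j) (map value ts)) ≡ count (peak j) ts + count (flat j) ts
  count-value-3^ j ts =
    trans (length-filter-map-value (ℤ._≟ + 3 ^ suc j) (λ t → δᵗ (peak j) t + δᵗ (flat j) t) accept reject ts)
          (total-+ (δᵗ (peak j)) (δᵗ (flat j)) ts)
    where
    index-injective : ∀ {i} → + 3 ^ suc i ≡ + 3 ^ suc j → j ≡ i
    index-injective 3^≡ = sym (ℕ.suc-injective (3^-injective (ℤ.+-injective 3^≡)))
    accept : ∀ t → value t ≡ + 3 ^ suc j → δᵗ (peak j) t + δᵗ (flat j) t ≡ 1
    accept one      1≡3^ = contradiction (sym (ℤ.+-injective 1≡3^)) (3^suc≢1 j)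
    accept (peak i) 3^≡  = trans (ℕ.+-identityʳ _) (subst (λ i → δ j i ≡ 1) (index-injective 3^≡) (δ-refl j))
    accept (flat i) 3^≡  = subst (λ i → δ j i ≡ 1) (index-injective 3^≡) (δ-refl j)
    reject : ∀ t → value t ≢ + 3 ^ suc j → δᵗ (peak j) t + δᵗ (flat j) t ≡ 0
    reject one      _    = refl
    reject (peak i) 3^≢  = trans (ℕ.+-identityʳ _) (δ-≢ {j} {i} λ j≡i → 3^≢ (cong (λ k → + 3 ^ suc k) (sym j≡i)))
    reject (flat i) 3^≢  = δ-≢ {j} {i} λ j≡i → 3^≢ (cong (λ k → + 3 ^ suc k) (sym j≡i))

  Window : Set
  Window = Maybe ℤ × ℤ × Maybe ℤ

  windows : Maybe ℤ → List ℤ → List Window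
  windows l []       = []
  windows l (c ∷ cs) = (l , c , head cs) ∷ windows (just c) cs

  IsPeak : ℤ → Window → Set
  IsPeak v (l , c , r) = c ≡ v × Maybe.All (ℤ._< c) l × Maybe.All (ℤ._< c) r

  isPeak? : ∀ v → Decidable (IsPeak v)
  isPeak? v (l , c , r) = (c ℤ.≟ v) ×-dec Maybe.dec (ℤ._<? c) l ×-dec Maybe.dec (ℤ._<? c) r

  peaks : ℤ → Maybe ℤ → List ℤ → ℕ
  peaks v l cs = length (filter (isPeak? v) (windows l cs))

  indicator : ∀ {a p} {A : Set a} {P : Pred A p} → Decidable P → A → ℕ
  indicator P? x = length (filter P? (x ∷ []))

  length-filter-∷ : ∀ {a p} {A : Set a} {P : Pred A p} (P? : Decidable P) x xs →
    length (filter P? (x ∷ xs)) ≡ indicator P? x + length (filter P? xs)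
  length-filter-∷ P? x xs with does (P? x)
  ... | true  = refl
  ... | false = refl

  peaks-triple : ∀ {v l u c u′ cs} → u ℤ.≤ c → u′ ℤ.≤ c →
    peaks v l (u ∷ c ∷ u′ ∷ cs) ≡ indicator (isPeak? v) (just u , c , just u′) + peaks v (just u′) cs
  peaks-triple {v} {l} {u} {c} {u′} {cs} u≤c u′≤c = begin
    length (filter P? (w₁ ∷ w₂ ∷ w₃ ∷ W))
      ≡⟨ cong length (filter-reject P? ¬peak₁) ⟩
    length (filter P? (w₂ ∷ w₃ ∷ W))
      ≡⟨ length-filter-∷ P? w₂ (w₃ ∷ W) ⟩
    indicator P? w₂ + length (filter P? (w₃ ∷ W))
      ≡⟨ cong (λ ws → indicator P? w₂ + length ws) (filter-reject P? ¬peak₃) ⟩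
    indicator P? w₂ + length (filter P? W) ∎
    where
    P? = isPeak? v
    w₁ w₂ w₃ : Window
    w₁ = (l , u , just c)
    w₂ = (just u , c , just u′)
    w₃ = (just c , u′ , head cs)
    W : List Window
    W = windows (just u′) cs
    ¬peak₁ : ¬ IsPeak v w₁
    ¬peak₁ (_ , _ , just c<u) = ℤ.≤⇒≯ u≤c c<u
    ¬peak₃ : ¬ IsPeak v w₃
    ¬peak₃ (_ , just c<u′ , _) = ℤ.≤⇒≯ u′≤c c<u′

  centre : Tag → Window
  centre s = (just (value (outer s)) , value (middle s) , just (value (outer s)))

  value-outer≤middle : ∀ s → value (outer s) ℤ.≤ value (middle s)
  value-outer≤middle one            = +≤+ (s≤s z≤n)
  value-outer≤middle (peak i)       = +≤+ (ℕ.^-monoʳ-≤ 3 (ℕ.n≤1+n (suc i)))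
  value-outer≤middle (flat zero)    = ℤ.≤-refl
  value-outer≤middle (flat (suc i)) = ℤ.≤-refl

  peaks-expand : ∀ v l ts → peaks v l (map value (expand ts)) ≡ total (indicator (isPeak? v) ∘ centre) ts
  peaks-expand v l []       = refl
  peaks-expand v l (s ∷ ts) =
    trans (peaks-triple (value-outer≤middle s) (value-outer≤middle s))
          (cong (λ n → indicator (isPeak? v) (centre s) + n) (peaks-expand v _ ts))

  isPeak-rise : ∀ {v u c} → u ℤ.< c → indicator (isPeak? v) (just u , c , just u) ≡ indicator (ℤ._≟ v) c
  isPeak-rise {v} {u} {c} u<c = by-cases (c ℤ.≟ v)
    where
    by-cases : Dec (c ≡ v) → indicator (isPeak? v) (just u , c , just u) ≡ indicator (ℤ._≟ v) c
    by-cases (yes c≡v) = trans (cong length (filter-accept (isPeak? v) {xs = []} (c≡v , just u<c , just u<c)))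
                               (sym (cong length (filter-accept (ℤ._≟ v) {xs = []} c≡v)))
    by-cases (no c≢v)  = trans (cong length (filter-reject (isPeak? v) {x = just u , c , just u} {xs = []}
                                                            λ (c≡v , _) → c≢v c≡v))
                               (sym (cong length (filter-reject (ℤ._≟ v) {xs = []} c≢v)))

  isPeak-plateau : ∀ {v} c → indicator (isPeak? v) (just c , c , just c) ≡ 0
  isPeak-plateau {v} c = cong length (filter-reject (isPeak? v) {x = just c , c , just c} {xs = []}
                                        λ { (_ , just c<c , _) → ℤ.<-irrefl refl c<c })

  peaks-3^ : ∀ j l ts → peaks (+ 3 ^ suc j) l (map value (expand ts)) ≡ count (peak j) (expand ts)
  peaks-3^ j l ts = trans (peaks-expand v l ts) (sym (count-expand (peak j) _ pointwise ts))
    where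
    v = + 3 ^ suc j
    value-indicator : ∀ i → indicator (ℤ._≟ v) (+ 3 ^ suc i) ≡ δ j i
    value-indicator i = trans (count-value-3^ j (peak i ∷ [])) (trans (ℕ.+-identityʳ _) (ℕ.+-identityʳ _))
    pointwise : ∀ s → 2 * δᵗ (peak j) (outer s) + δᵗ (peak j) (middle s) ≡ indicator (isPeak? v) (centre s)
    pointwise one            = sym (trans (isPeak-rise {v} (+<+ (s≤s (s≤s z≤n)))) (value-indicator 0))
    pointwise (peak i)       =
      sym (trans (isPeak-rise {v} (+<+ (ℕ.^-monoʳ-< 3 (s≤s (s≤s z≤n)) (ℕ.n<1+n (suc i))))) (value-indicator (suc i)))
    pointwise (flat zero)    = sym (isPeak-plateau {v} (+ 1))
    pointwise (flat (suc i)) = sym (isPeak-plateau {v} (+ 3 ^ suc i))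

  lookupᵈ : ∀ {a} {A : Set a} → A → List A → ℕ → A
  lookupᵈ d []       _       = d
  lookupᵈ d (x ∷ _)  zero    = x
  lookupᵈ d (_ ∷ xs) (suc i) = lookupᵈ d xs i

  length-filter-applyUpTo : ∀ {a p q} {A : Set a} {P : Pred ℕ p} {Q : Pred A q} (P? : Decidable P) (Q? : Decidable Q)
    (d : A) (xs : List A) (g : ℕ → ℕ) → (∀ i → i < length xs → P (g i) ⇔ Q (lookupᵈ d xs i)) →
    length (filter P? (applyUpTo g (length xs))) ≡ length (filter Q? xs)
  length-filter-applyUpTo P? Q? d []       g P⇔Q = refl
  length-filter-applyUpTo P? Q? d (x ∷ xs) g P⇔Q with P? (g 0) | Q? x
  ... | yes p | yes q = cong suc (length-filter-applyUpTo P? Q? d xs (λ i → g (suc i)) (λ i i<n → P⇔Q (suc i) (s≤s i<n)))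
  ... | yes p | no ¬q = contradiction (Equivalence.to (P⇔Q 0 (s≤s z≤n)) p) ¬q
  ... | no ¬p | yes q = contradiction (Equivalence.from (P⇔Q 0 (s≤s z≤n)) q) ¬p
  ... | no ¬p | no ¬q = length-filter-applyUpTo P? Q? d xs (λ i → g (suc i)) (λ i i<n → P⇔Q (suc i) (s≤s i<n))

  All-lookupᵈ-just : ∀ {p} {P : Pred ℤ p} cs k →
    Maybe.All P (lookupᵈ nothing (map just cs) k) ⇔ (k < length cs → P (nth cs k))
  All-lookupᵈ-just []       k       = mk⇔ (λ _ ()) (λ _ → nothing)
  All-lookupᵈ-just (c ∷ cs) zero    = mk⇔ (λ { (just p) _ → p }) (λ f → just (f (s≤s z≤n)))
  All-lookupᵈ-just (c ∷ cs) (suc k) = mk⇔ (λ a k<n → to a (ℕ.≤-pred k<n)) (λ f → from (f ∘ s≤s))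
    where
    open Equivalence (All-lookupᵈ-just cs k)

  window : Maybe ℤ → List ℤ → ℕ → Window
  window l cs i = (lookupᵈ nothing (l ∷ map just cs) i , nth cs i , lookupᵈ nothing (map just cs) (suc i))

  lookupᵈ-windows : ∀ d l cs i → i < length cs → lookupᵈ d (windows l cs) i ≡ window l cs i
  lookupᵈ-windows d l (c ∷ [])      zero    _         = refl
  lookupᵈ-windows d l (c ∷ c′ ∷ cs) zero    _         = refl
  lookupᵈ-windows d l (c ∷ cs)      (suc i) (s≤s i<n) = lookupᵈ-windows d (just c) cs i i<n

  isPeak-window : ∀ v cs N → N ≡ length cs → ∀ i → i < N →
    (nth cs i ≡ v × (1 ≤ i → nth cs (i ∸ 1) ℤ.< nth cs i) × (suc i < N → nth cs (suc i) ℤ.< nth cs i))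
      ⇔ IsPeak v (window nothing cs i)
  isPeak-window v cs _ refl i i<n = mk⇔
    (λ (c≡v , left , right) → c≡v , to (previous i i<n) left , from (All-lookupᵈ-just cs (suc i)) right)
    (λ (c≡v , left , right) → c≡v , from (previous i i<n) left , to (All-lookupᵈ-just cs (suc i)) right)
    where
    open Equivalence
    c = nth cs i
    previous : ∀ k → k < length cs →
      (1 ≤ k → nth cs (k ∸ 1) ℤ.< c) ⇔ Maybe.All (ℤ._< c) (lookupᵈ nothing (nothing ∷ map just cs) k)
    previous zero    _     = mk⇔ (λ _ → nothing) (λ _ ())
    previous (suc k) 1+k<n = mk⇔
      (λ f → from (All-lookupᵈ-just cs k) (λ _ → f (s≤s z≤n)))
      (λ a _ → to (All-lookupᵈ-just cs k) a (ℕ.<-trans (ℕ.n<1+n k) 1+k<n))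

  length-windows : ∀ l cs → length (windows l cs) ≡ length cs
  length-windows l []       = refl
  length-windows l (c ∷ cs) = cong suc (length-windows (just c) cs)

  length-expand : ∀ ts → length (expand ts) ≡ 3 * length ts
  length-expand []       = refl
  length-expand (t ∷ ts) = trans (cong (λ n → 3 + n) (length-expand ts)) (sym (ℕ.*-distribˡ-+ 3 1 (length ts)))

  length-dets-SB : ∀ n → length (dets (SB n)) ≡ 3 ^ n
  length-dets-SB n = trans (cong length (dets-SB n)) (trans (length-map value (tags n)) (length-tags n))
    where
    length-tags : ∀ n → length (tags n) ≡ 3 ^ n
    length-tags zero    = refl
    length-tags (suc n) = trans (length-expand (tags n)) (cong (3 *_) (length-tags n))

  nth≡lookupᵈ : ∀ cs i → nth cs i ≡ lookupᵈ (+ 0) cs i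
  nth≡lookupᵈ []       i       = refl
  nth≡lookupᵈ (c ∷ cs) zero    = refl
  nth≡lookupᵈ (c ∷ cs) (suc i) = nth≡lookupᵈ cs i

  countVal≡ : ∀ n v → countVal n v ≡ length (filter (ℤ._≟ v) (map value (tags n)))
  countVal≡ n v = begin
    length (filter (λ i → C n i ℤ.≟ v) (upTo (3 ^ n)))
      ≡⟨ cong (λ N → length (filter (λ i → C n i ℤ.≟ v) (upTo N))) (sym (length-dets-SB n)) ⟩
    length (filter (λ i → C n i ℤ.≟ v) (upTo (length cs)))
      ≡⟨ length-filter-applyUpTo (λ i → C n i ℤ.≟ v) (ℤ._≟ v) (+ 0) cs (λ i → i) at-index ⟩
    length (filter (ℤ._≟ v) cs)
      ≡⟨ cong (λ cs → length (filter (ℤ._≟ v) cs)) (dets-SB n) ⟩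
    length (filter (ℤ._≟ v) (map value (tags n))) ∎
    where
    cs = dets (SB n)
    at-index : ∀ i → i < length cs → (C n i ≡ v) ⇔ (lookupᵈ (+ 0) cs i ≡ v)
    at-index i _ rewrite nth≡lookupᵈ cs i = mk⇔ (λ x → x) (λ x → x)

  countPeak≡ : ∀ n v → countPeak n v ≡ peaks v nothing (map value (tags n))
  countPeak≡ n v = begin
    length (filter P? (upTo (3 ^ n)))
      ≡⟨ cong (λ N → length (filter P? (upTo N))) (sym (trans (length-windows nothing cs) (length-dets-SB n))) ⟩
    length (filter P? (upTo (length (windows nothing cs))))
      ≡⟨ length-filter-applyUpTo P? (isPeak? v) (nothing , + 0 , nothing) (windows nothing cs) (λ i → i) at-index ⟩
    peaks v nothing cs
      ≡⟨ cong (peaks v nothing) (dets-SB n) ⟩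
    peaks v nothing (map value (tags n)) ∎
    where
    cs = dets (SB n)
    P? = λ i → (C n i ℤ.≟ v) ×-dec peak? n i
    at-index : ∀ i → i < length (windows nothing cs) →
      (C n i ≡ v × Peak n i) ⇔ IsPeak v (lookupᵈ (nothing , + 0 , nothing) (windows nothing cs) i)
    at-index i i<n rewrite lookupᵈ-windows (nothing , + 0 , nothing) nothing cs i (subst (i <_) (length-windows nothing cs) i<n) =
      isPeak-window v cs (3 ^ n) (sym (length-dets-SB n)) i (subst (i <_) (trans (length-windows nothing cs) (length-dets-SB n)) i<n)

  countNonPeak+countPeak : ∀ n v → countNonPeak n v + countPeak n v ≡ countVal n v
  countNonPeak+countPeak n v = split (λ i → C n i ℤ.≟ v) (peak? n) (upTo (3 ^ n))
    where
    split : ∀ {P Q : ℕ → Set} (P? : Decidable P) (Q? : Decidable Q) xs →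
      length (filter (λ i → P? i ×-dec ¬? (Q? i)) xs) + length (filter (λ i → P? i ×-dec Q? i) xs) ≡ length (filter P? xs)
    split P? Q? [] = refl
    split P? Q? (x ∷ xs) with P? x | Q? x
    ... | yes _ | yes _ = trans (ℕ.+-suc _ _) (cong suc (split P? Q? xs))
    ... | yes _ | no _  = cong suc (split P? Q? xs)
    ... | no _  | yes _ = split P? Q? xs
    ... | no _  | no _  = split P? Q? xs

  countVal-one : ∀ n → countVal n (+ 1) ≡ tagCount one n
  countVal-one n = trans (countVal≡ n (+ 1)) (count-value-one (tags n))

  countVal-3^ : ∀ j m → countVal (suc j + m) (+ 3 ^ suc j) ≡ tagCount one m + half-a m
  countVal-3^ j m = begin
    countVal n (+ 3 ^ suc j)
      ≡⟨ countVal≡ n (+ 3 ^ suc j) ⟩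
    length (filter (ℤ._≟ + 3 ^ suc j) (map value (tags n)))
      ≡⟨ count-value-3^ j (tags n) ⟩
    tagCount (peak j) n + tagCount (flat j) n
      ≡⟨ cong₂ _+_ (tagCount-peak j m) (tagCount-flat j m) ⟩
    tagCount one m + half-a m ∎
    where
    n = suc j + m

  countPeak-3^ : ∀ j m → countPeak (suc j + m) (+ 3 ^ suc j) ≡ tagCount one m
  countPeak-3^ j m = begin
    countPeak (suc j + m) (+ 3 ^ suc j)                              ≡⟨ countPeak≡ (suc j + m) (+ 3 ^ suc j) ⟩
    peaks (+ 3 ^ suc j) nothing (map value (expand (tags (j + m))))  ≡⟨ peaks-3^ j nothing (tags (j + m)) ⟩
    tagCount (peak j) (suc j + m)                                    ≡⟨ tagCount-peak j m ⟩
    tagCount one m                                                   ∎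

  countNonPeak-3^ : ∀ j m → countNonPeak (suc j + m) (+ 3 ^ suc j) ≡ half-a m
  countNonPeak-3^ j m = ℕ.+-cancelʳ-≡ (tagCount one m) _ _ (begin
    countNonPeak n v + tagCount one m  ≡⟨ cong (λ k → countNonPeak n v + k) (countPeak-3^ j m) ⟨
    countNonPeak n v + countPeak n v   ≡⟨ countNonPeak+countPeak n v ⟩
    countVal n v                       ≡⟨ countVal-3^ j m ⟩
    tagCount one m + half-a m          ≡⟨ ℕ.+-comm (tagCount one m) (half-a m) ⟩
    half-a m + tagCount one m          ∎)
    where
    n = suc j + m
    v = + 3 ^ suc j

open import Data.Nat as ℕ using (ℕ; zero; suc; _≤_; _∸_; _^_)
import Data.Nat.Properties as ℕ
open import Data.Nat.DivMod using (m*n/n≡m)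
open import Data.Nat.Tactic.RingSolver using (solve-∀)
open import Data.Integer as ℤ using (ℤ; +_; -1ℤ; _+_; _*_; _-_; _/ℕ_)
import Data.Integer.Properties as ℤ
import Data.Integer.Tactic.RingSolver as ℤ-Ring
open import Data.Product using (_×_; _,_)
open import Relation.Binary.PropositionalEquality
open ≡-Reasoning
open Intervals using (one)
open Counting using (tagCount; half-a; tagCount-one-suc; countVal-one; countVal-3^; countPeak-3^; countNonPeak-3^)

a-rec : ∀ m → a (suc (suc m)) ≡ + 2 * a (suc m) + + 3 * a m
a-rec m = begin
  + (3 ℕ.* (3 ℕ.* X)) - -1ℤ * (-1ℤ * s)
    ≡⟨ cong (_- -1ℤ * (-1ℤ * s)) (trans (ℤ.pos-* 3 (3 ℕ.* X)) (cong (+ 3 *_) (ℤ.pos-* 3 X))) ⟩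
  + 3 * (+ 3 * + X) - -1ℤ * (-1ℤ * s)
    ≡⟨ recurrence (+ X) s ⟩
  + 2 * (+ 3 * + X - -1ℤ * s) + + 3 * (+ X - s)
    ≡⟨ cong (λ x → + 2 * (x - -1ℤ * s) + + 3 * (+ X - s)) (ℤ.pos-* 3 X) ⟨
  + 2 * a (suc m) + + 3 * a m ∎
  where
  X = 3 ^ m
  s = -1ℤ ℤ.^ m
  recurrence : ∀ x s → + 3 * (+ 3 * x) - -1ℤ * (-1ℤ * s) ≡ + 2 * (+ 3 * x - -1ℤ * s) + + 3 * (x - s)
  recurrence = ℤ-Ring.solve-∀

a≡2*half-a : ∀ m → a m ≡ + (2 ℕ.* half-a m)
a≡2*half-a zero          = refl
a≡2*half-a (suc zero)    = refl
a≡2*half-a (suc (suc m)) = begin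
  a (suc (suc m))
    ≡⟨ a-rec m ⟩
  + 2 * a (suc m) + + 3 * a m
    ≡⟨ cong₂ (λ x y → + 2 * x + + 3 * y) (a≡2*half-a (suc m)) (a≡2*half-a m) ⟩
  + 2 * + (2 ℕ.* h₁) + + 3 * + (2 ℕ.* h₀)
    ≡⟨ cong₂ _+_ (ℤ.pos-* 2 (2 ℕ.* h₁)) (ℤ.pos-* 3 (2 ℕ.* h₀)) ⟨
  + (2 ℕ.* (2 ℕ.* h₁)) + + (3 ℕ.* (2 ℕ.* h₀))
    ≡⟨ ℤ.pos-+ (2 ℕ.* (2 ℕ.* h₁)) (3 ℕ.* (2 ℕ.* h₀)) ⟨
  + (2 ℕ.* (2 ℕ.* h₁) ℕ.+ 3 ℕ.* (2 ℕ.* h₀))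
    ≡⟨ cong +_ (distrib h₁ h₀) ⟩
  + (2 ℕ.* half-a (suc (suc m))) ∎
  where
  h₁ = half-a (suc m)
  h₀ = half-a m
  distrib : ∀ x y → 2 ℕ.* (2 ℕ.* x) ℕ.+ 3 ℕ.* (2 ℕ.* y) ≡ 2 ℕ.* (2 ℕ.* x ℕ.+ 3 ℕ.* y)
  distrib = solve-∀

a/2≡half-a : ∀ m → a m /ℕ 2 ≡ + half-a m
a/2≡half-a m = begin
  a m /ℕ 2                  ≡⟨ cong (_/ℕ 2) (a≡2*half-a m) ⟩
  + (2 ℕ.* half-a m) /ℕ 2   ≡⟨ cong (λ x → + (x ℕ./ 2)) (ℕ.*-comm 2 (half-a m)) ⟩
  + (half-a m ℕ.* 2 ℕ./ 2)  ≡⟨ cong +_ (m*n/n≡m (half-a m) 2) ⟩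
  + half-a m                ∎

a≡a/2+a/2 : ∀ m → a m ≡ a m /ℕ 2 + a m /ℕ 2
a≡a/2+a/2 m = begin
  a m                      ≡⟨ a≡2*half-a m ⟩
  + (2 ℕ.* half-a m)       ≡⟨ cong +_ (cong (half-a m ℕ.+_) (ℕ.+-identityʳ (half-a m))) ⟩
  + (half-a m ℕ.+ half-a m) ≡⟨ ℤ.pos-+ (half-a m) (half-a m) ⟩
  + half-a m + + half-a m  ≡⟨ cong₂ _+_ (a/2≡half-a m) (a/2≡half-a m) ⟨
  a m /ℕ 2 + a m /ℕ 2      ∎

tagCount-one≡b+a/2 : ∀ m → + tagCount one m ≡ b m + a m /ℕ 2
tagCount-one≡b+a/2 zero    = refl
tagCount-one≡b+a/2 (suc m) = begin
  + tagCount one (suc m)      ≡⟨ cong +_ (tagCount-one-suc m) ⟩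
  + half-a (suc m)            ≡⟨ a/2≡half-a (suc m) ⟨
  a (suc m) /ℕ 2              ≡⟨ ℤ.+-identityˡ _ ⟨
  b (suc m) + a (suc m) /ℕ 2  ∎

count-one-theorem : ∀ n → + countVal n (+ 1) ≡ b n + (a n /ℕ 2)
count-one-theorem n = trans (cong +_ (countVal-one n)) (tagCount-one≡b+a/2 n)

counts-3^ : ∀ j m → let n = suc j ℕ.+ m ; v = + 3 ^ suc j in
  (+ countVal n v ≡ b m + a m) × (+ countPeak n v ≡ b m + (a m /ℕ 2)) × (+ countNonPeak n v ≡ a m /ℕ 2)
counts-3^ j m = values , trans (cong +_ (countPeak-3^ j m)) (tagCount-one≡b+a/2 m) ,
                trans (cong +_ (countNonPeak-3^ j m)) (sym (a/2≡half-a m))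
  where
  values : + countVal (suc j ℕ.+ m) (+ 3 ^ suc j) ≡ b m + a m
  values = begin
    + countVal (suc j ℕ.+ m) (+ 3 ^ suc j)  ≡⟨ cong +_ (countVal-3^ j m) ⟩
    + (tagCount one m ℕ.+ half-a m)         ≡⟨ ℤ.pos-+ (tagCount one m) (half-a m) ⟩
    + tagCount one m + + half-a m           ≡⟨ cong₂ _+_ (tagCount-one≡b+a/2 m) (sym (a/2≡half-a m)) ⟩
    b m + a m /ℕ 2 + a m /ℕ 2               ≡⟨ ℤ.+-assoc (b m) (a m /ℕ 2) (a m /ℕ 2) ⟩
    b m + (a m /ℕ 2 + a m /ℕ 2)             ≡⟨ cong (λ x → b m + x) (a≡a/2+a/2 m) ⟨
    b m + a m                               ∎

count-3^-theorem : (n k : ℕ) → 1 ≤ k → k ≤ n →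
  (+ countVal n (+ (3 ^ k)) ≡ b (n ∸ k) + a (n ∸ k))
  × (+ countPeak n (+ (3 ^ k)) ≡ b (n ∸ k) + (a (n ∸ k) /ℕ 2))
  × (+ countNonPeak n (+ (3 ^ k)) ≡ a (n ∸ k) /ℕ 2)
count-3^-theorem n (suc j) _ k≤n with ℕ.m≤n⇒∃[o]m+o≡n k≤n
... | m , refl rewrite ℕ.m+n∸m≡n j m = counts-3^ j m

theorem23 : ((n : ℕ) → + countVal n (+ 1) ≡ b n + (a n /ℕ 2))
    × ((n k : ℕ) → 1 ≤ k → k ≤ n →
        (+ countVal n (+ (3 ^ k)) ≡ b (n ∸ k) + a (n ∸ k))
        × (+ countPeak n (+ (3 ^ k)) ≡ b (n ∸ k) + (a (n ∸ k) /ℕ 2))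
        × (+ countNonPeak n (+ (3 ^ k)) ≡ a (n ∸ k) /ℕ 2))
theorem23 = count-one-theorem , count-3^-theorem
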